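{- Let $\ell\ge2$ be an integer and let $x<z$ be positive integers. The following conditions are equivalent: (i) $x<z$ are consecutive elements of $\overline{\mathcal{V}}_{\ell+1}$ but not consecutive elements of $\overline{\mathcal{V}}_\ell$; (ii) there exists $y\in\overline{\mathcal{V}}_\ell\setminus\overline{\mathcal{V}}_{\ell+1}$ such that $x<y<z$ are consecutive elements of $\overline{\mathcal{V}}_\ell$; (iii) $x<z$ are consecutive elements of $\overline{\mathcal{V}}_{\ell+1}$ and $z-x=F_\ell$.
   Context: Fibonacci numbers: $F_{ -1}=0$, $F_0=1$, $F_{i+2}=F_{i+1}+F_i$; $\overline{\mathcal{F}}=\{F_i: i\ge-1\}$. Define $\bar\iota:\mathbb{N}\to\mathbb{N}$ by $\bar\iota(x)=x$ if $x\in\overline{\mathcal{F}}$, and $\bar\iota(x)=x-2F_{i-2}$ if $F_i<x<F_{i+1}$ for an integer $i\ge3$; $\bar\alpha(x)=\lim_k\bar\iota^k(x)$; $\overline{\mathcal{V}}_\ell=\{x\in\mathbb{N}: \bar\alpha(x)\ge F_\ell\}$. Elements $x_1<\dots<x_k$ of a set $\overline{\mathcal{V}}_j$ are consecutive in it if they are all the elements of $\overline{\mathcal{V}}_j\cap[x_1,x_k]$. -}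

module Defs where

open import Data.Nat using (ℕ; zero; suc; _+_; _*_; _∸_; _≤_; _<_; _≤?_; _<?_; _≟_)
open import Data.Bool using (Bool; true; false; if_then_else_)
open import Data.Product using (Σ; ∃; _×_)
open import Data.Sum using (_⊎_)
open import Relation.Nullary using (does)
open import Relation.Binary.PropositionalEquality using (_≡_)
open import Function using (_∘_)

fib : ℕ → ℕ
fib zero = 0
fib (suc zero) = 1
fib (suc (suc n)) = fib (suc n) + fib n

-- The paper's indexing: F_i = fib (i + 1), so F_0 = 1, F_1 = 1, F_2 = 2, ...
-- and F_{-1} = 0 = fib 0.
F : ℕ → ℕ
F i = fib (suc i)

-- Membership in the set  F̄ = { F_i : i ≥ -1 } = { fib j : j ≥ 0 }.
InFibSet : ℕ → Set
InFibSet x = ∃ λ j → fib j ≡ x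

-- Boolean test: is x among fib 0, …, fib (x + 1)?  (fib j ≥ j - 1, so this suffices.)
isFibB : ℕ → Bool
isFibB x = go (suc (suc x))
  where
  go : ℕ → Bool
  go zero = false
  go (suc k) = if does (fib k ≟ x) then true else go k

-- Least i ≤ bound such that x < F (suc i), searching i = 0, 1, 2, …
-- (with fuel x + 1, which suffices since F (x + 1) > x).
idx : ℕ → ℕ
idx x = go 0 (suc x)
  where
  go : ℕ → ℕ → ℕ
  go i zero = i
  go i (suc fuel) = if does (x <? F (suc i)) then i else go (suc i) fuel

-- ῑ(x) = x if x ∈ F̄; otherwise x - 2 F_{i-2} where F_i < x < F_{i+1}
-- (for x ∉ F̄ this i is idx x, and necessarily i ≥ 3).
iotaBar : ℕ → ℕ
iotaBar x = if isFibB x then x else x ∸ 2 * F (idx x ∸ 2)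

iterate : (ℕ → ℕ) → ℕ → ℕ → ℕ
iterate f zero x = x
iterate f (suc k) x = f (iterate f k x)

-- a is the limit of the sequence ῑ^k(x) (a sequence in ℕ, discrete topology:
-- eventually constant equal to a).
IsAlphaBar : ℕ → ℕ → Set
IsAlphaBar x a = ∃ λ K → ∀ k → K ≤ k → iterate iotaBar k x ≡ a

VBar : ℕ → ℕ → Set
VBar ℓ x = ∃ λ a → IsAlphaBar x a × F ℓ ≤ a

Consec2 : ℕ → ℕ → ℕ → Set
Consec2 ℓ x z =
  x < z × VBar ℓ x × VBar ℓ z ×
  (∀ w → x ≤ w → w ≤ z → VBar ℓ w → w ≡ x ⊎ w ≡ z)

Consec3 : ℕ → ℕ → ℕ → ℕ → Set
Consec3 ℓ x y z =
  x < y × y < z × VBar ℓ x × VBar ℓ y × VBar ℓ z ×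
  (∀ w → x ≤ w → w ≤ z → VBar ℓ w → w ≡ x ⊎ w ≡ y ⊎ w ≡ z)

-- ῑ sends F (3 + m) + y to F m + y for 0 < y < F (2 + m), so ᾱ, and with it membership in
-- every V̄_j, is unchanged under F m + y ↦ F (3 + m) + y. For m ≥ ℓ + 1 both ends of the window
-- [F m, F m + F (2 + m)] lie in V̄_{ℓ+1}, so V̄_ℓ and V̄_{ℓ+1} look the same on it as on
-- [F (3 + m), F (4 + m)]. Strong induction, starting from the window [F (ℓ + 1), F (ℓ + 4)]
-- computed by hand, then shows that consecutive elements x < z of V̄_{ℓ+1} satisfy either
-- z = x + F_{ℓ-1} with no element of V̄_ℓ between them, or z = x + F_ℓ with exactly one, which
-- is not in V̄_{ℓ+1}. Hence no two consecutive elements of V̄_ℓ lie outside V̄_{ℓ+1}, and each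
-- of (i)-(iii) says that x < z is a gap of the second kind.

module Submission where

open import Defs
open import Data.Nat using (ℕ; suc; _≤_; _<_; _∸_)
open import Data.Product using (Σ; ∃; _×_)
open import Relation.Nullary using (¬_)
open import Relation.Binary.PropositionalEquality using (_≡_)
open import Function.Bundles using (_⇔_)

open import Data.Bool using (Bool; true; false; if_then_else_)
open import Data.Empty using (⊥; ⊥-elim)
open import Data.Nat using (zero; _+_; _*_; z≤n; s≤s; _≟_; _<?_; _≤?_; _<ᵇ_; _≡ᵇ_)
open import Data.Nat.Induction using (<-rec)
open import Data.Nat.Properties
open import Data.Nat.Tactic.RingSolver using (solve-∀)
open import Data.Product using (_,_; proj₁; ∃₂)
open import Data.Product.Function.NonDependent.Propositional using (_×-⇔_)
open import Data.Sum using (_⊎_; inj₁; inj₂)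
open import Function.Base using (_∘_)
open import Function.Bundles using (mk⇔)
open import Function.Properties.Equivalence using () renaming (refl to ⇔-refl; sym to ⇔-sym; trans to ⇔-trans)
open import Function.Related.TypeIsomorphisms using (→-cong-⇔)
open import Relation.Binary.PropositionalEquality using (_≢_; refl; sym; trans; cong; subst; module ≡-Reasoning)
open import Relation.Nullary using (Dec; yes; no; does)
open import Relation.Nullary.Decidable using (decidable-stable; dec-true; dec-false; map′)
open import Relation.Unary using (Decidable)
open import Relation.Binary.Definitions using (tri<; tri≈; tri>)

offset : ∀ {c w} → c ≤ w → ∃ λ y → w ≡ c + y
offset {c} {w} c≤w = w ∸ c , sym (m+[n∸m]≡n c≤w)

above-base : ∀ c {lo w} → c + lo < w → ∃ λ y → w ≡ c + y × lo < y
above-base c {lo} c+lo<w with offset (≤-trans (m≤m+n c lo) (<⇒≤ c+lo<w))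
... | y , refl = y , refl , +-cancelˡ-< c lo y c+lo<w

+-rebase : ∀ c c' {u v d} → c + v ≡ c + u + d → c' + v ≡ c' + u + d
+-rebase c c' {u} {v} {d} c+v≡c+u+d = trans (cong (c' +_) v≡u+d) (sym (+-assoc c' u d))
  where
  v≡u+d : v ≡ u + d
  v≡u+d = +-cancelˡ-≡ c v (u + d) (trans c+v≡c+u+d (+-assoc c u d))

fib-≤-suc : ∀ n → fib n ≤ fib (suc n)
fib-≤-suc zero    = z≤n
fib-≤-suc (suc n) = m≤m+n (fib (suc n)) (fib n)

fib-mono : ∀ {m n} → m ≤ n → fib m ≤ fib n
fib-mono {n = zero}  z≤n = ≤-refl
fib-mono {n = suc n} m≤1+n with m≤n⇒m<n∨m≡n m≤1+n
... | inj₁ m<1+n = ≤-trans (fib-mono (≤-pred m<1+n)) (fib-≤-suc n)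
... | inj₂ refl  = ≤-refl

F-mono : ∀ {m n} → m ≤ n → F m ≤ F n
F-mono m≤n = fib-mono (s≤s m≤n)

F-pos : ∀ i → 0 < F i
F-pos zero    = s≤s z≤n
F-pos (suc i) = ≤-trans (F-pos i) (m≤m+n (F i) (fib i))

F₊₁<F₊₂ : ∀ i → F (suc i) < F (2 + i)
F₊₁<F₊₂ i = m<m+n (F (suc i)) (F-pos i)

F<F₊₂ : ∀ i → F i < F (2 + i)
F<F₊₂ i = m<n+m (F i) (F-pos (suc i))

n<F-suc : ∀ n → n < F (suc n)
n<F-suc zero    = s≤s z≤n
n<F-suc (suc n) = <-≤-trans (s≤s (n<F-suc n)) (F₊₁<F₊₂ n)

n≤F : ∀ n → n ≤ F n
n≤F zero    = z≤n
n≤F (suc n) = n<F-suc n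

F-interval : ∀ {s x} → F s ≤ x → ∃ λ i → s ≤ i × F i ≤ x × x < F (suc i)
F-interval {s} {x} Fs≤x = below (suc x) (n<F-suc x)
  where
  below : ∀ j → x < F j → ∃ λ i → s ≤ i × F i ≤ x × x < F (suc i)
  below zero    x<F₀ = ⊥-elim (<⇒≱ (≤-<-trans Fs≤x x<F₀) (F-pos s))
  below (suc i) x<Fi+1 with F i ≤? x
  ... | no  Fi≰x = below i (≰⇒> Fi≰x)
  ... | yes Fi≤x = i , s≤i , Fi≤x , x<Fi+1
    where
    s≤i : s ≤ i
    s≤i = ≮⇒≥ λ i<s → <⇒≱ x<Fi+1 (≤-trans (F-mono i<s) Fs≤x)

fibSearch : ℕ → ℕ → Bool
fibSearch x zero    = false
fibSearch x (suc k) = if does (fib k ≟ x) then true else fibSearch x k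

idxSearch : ℕ → ℕ → ℕ → ℕ
idxSearch x i zero       = i
idxSearch x i (suc fuel) = if does (x <? F (suc i)) then i else idxSearch x (suc i) fuel

fibSearch-unique : ∀ {x} (h : ℕ → Bool) → h 0 ≡ false →
  (∀ k → h (suc k) ≡ (if does (fib k ≟ x) then true else h k)) → ∀ k → h k ≡ fibSearch x k
fibSearch-unique h h₀ hₛ zero    = h₀
fibSearch-unique h h₀ hₛ (suc k) = trans (hₛ k) (cong (if_then_else_ _ true) (fibSearch-unique h h₀ hₛ k))

idxSearch-unique : ∀ {x} (h : ℕ → ℕ → ℕ) → (∀ i → h i 0 ≡ i) →
  (∀ i k → h i (suc k) ≡ (if does (x <? F (suc i)) then i else h (suc i) k)) →
  ∀ i k → h i k ≡ idxSearch x i k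
idxSearch-unique h h₀ hₛ i zero    = h₀ i
idxSearch-unique h h₀ hₛ i (suc k) = trans (hₛ i k) (cong (if_then_else_ _ i) (idxSearch-unique h h₀ hₛ (suc i) k))

-- The loops of isFibB and idx are local to Defs and have no name. The metavariable `loop`
-- is solved by unification once it meets the hidden loop applied to two distinct
-- variables, which the `with` abstractions arrange; the explicit λ is what remains of
-- the first iterations after reduction.
isFibB≡fibSearch : ∀ x → isFibB x ≡ fibSearch x (2 + x)
isFibB≡fibSearch = unfolded
  where
  loop : ℕ → ℕ → Bool
  loop = _
  unfolded : ∀ x → isFibB x ≡ fibSearch x (2 + x)
  unfolded zero = refl
  unfolded (suc y) with suc y
  ... | X with y
  ... | n = cong (λ b → if fib X + fib n ≡ᵇ X then true else if fib X ≡ᵇ X then true else if fib n ≡ᵇ X then true else b)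
                 (fibSearch-unique (loop X) refl (λ _ → refl) n)

idx≡idxSearch : ∀ x → idx x ≡ idxSearch x 0 (suc x)
idx≡idxSearch = unfolded
  where
  loop : ℕ → ℕ → ℕ → ℕ
  loop = _
  unfolded : ∀ x → idx x ≡ idxSearch x 0 (suc x)
  unfolded zero = refl
  unfolded (suc y) with suc y
  ... | X with y
  ... | n with 2
  ... | i = cong (λ r → if n <ᵇ 1 then 1 else r) (idxSearch-unique (loop X) (λ _ → refl) (λ _ _ → refl) i n)

if-yes : ∀ {A B : Set} (a? : Dec A) {t e : B} → A → (if does a? then t else e) ≡ t
if-yes a? {t} {e} a = cong (λ c → if c then t else e) (dec-true a? a)

if-no : ∀ {A B : Set} (a? : Dec A) {t e : B} → ¬ A → (if does a? then t else e) ≡ e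
if-no a? {t} {e} ¬a = cong (λ c → if c then t else e) (dec-false a? ¬a)

fibSearch-hit : ∀ {x j} k → fib j ≡ x → j < k → fibSearch x k ≡ true
fibSearch-hit {x} (suc k) fj≡x j<1+k with fib k ≟ x
... | yes fk≡x = if-yes (fib k ≟ x) fk≡x
... | no  fk≢x = trans (if-no (fib k ≟ x) fk≢x)
                       (fibSearch-hit k fj≡x (≤∧≢⇒< (≤-pred j<1+k) λ { refl → fk≢x fj≡x }))

fibSearch-miss : ∀ {x} k → (∀ j → fib j ≢ x) → fibSearch x k ≡ false
fibSearch-miss zero    _      = refl
fibSearch-miss {x} (suc k) ¬fib = trans (if-no (fib k ≟ x) (¬fib k)) (fibSearch-miss k ¬fib)

idxSearch-finds : ∀ {x} fuel {i t} → i ≤ t → t < i + fuel → F t ≤ x → x < F (suc t) → idxSearch x i fuel ≡ t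
idxSearch-finds zero {i} i≤t t<i+0 _ _ = ⊥-elim (<⇒≱ t<i+0 (≤-trans (≤-reflexive (+-identityʳ i)) i≤t))
idxSearch-finds {x} (suc fuel) {i} {t} i≤t t<i+1+fuel Ft≤x x<Ft+1 with x <? F (suc i)
... | yes x<Fi+1 = trans (if-yes (x <? F (suc i)) x<Fi+1)
                         (≤-antisym i≤t (≮⇒≥ λ i<t → <⇒≱ x<Fi+1 (≤-trans (F-mono i<t) Ft≤x)))
... | no  x≮Fi+1 = trans (if-no (x <? F (suc i)) x≮Fi+1)
                         (idxSearch-finds fuel i<t (subst (t <_) (+-suc i fuel) t<i+1+fuel) Ft≤x x<Ft+1)
  where
  i<t : i < t
  i<t = ≤∧≢⇒< i≤t λ { refl → x≮Fi+1 x<Ft+1 }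

fib-between-not-fib : ∀ i {x} → fib i < x → x < fib (suc i) → ∀ j → fib j ≢ x
fib-between-not-fib i fi<x x<fi+1 j refl with j ≤? i
... | yes j≤i = <⇒≱ fi<x (fib-mono j≤i)
... | no  j≰i = <⇒≱ x<fi+1 (fib-mono (≰⇒> j≰i))

isFibB-fib : ∀ j → isFibB (fib j) ≡ true
isFibB-fib zero    = refl
isFibB-fib (suc j) = trans (isFibB≡fibSearch (fib (suc j))) (fibSearch-hit (2 + F j) refl (s≤s (s≤s (n≤F j))))

isFibB-between : ∀ i {x} → fib i < x → x < fib (suc i) → isFibB x ≡ false
isFibB-between i {x} fi<x x<fi+1 = trans (isFibB≡fibSearch x) (fibSearch-miss (2 + x) (fib-between-not-fib i fi<x x<fi+1))

idx-between : ∀ i {x} → F i ≤ x → x < F (suc i) → idx x ≡ i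
idx-between i {x} Fi≤x x<Fi+1 = trans (idx≡idxSearch x) (idxSearch-finds (suc x) z≤n (s≤s (≤-trans (n≤F i) Fi≤x)) Fi≤x x<Fi+1)

-- The maps ῑ and ᾱ

iotaBar-≤ : ∀ x → iotaBar x ≤ x
iotaBar-≤ x with isFibB x
... | true  = ≤-refl
... | false = m∸n≤m x (2 * F (idx x ∸ 2))

iotaBar-fib : ∀ j → iotaBar (fib j) ≡ fib j
iotaBar-fib j rewrite isFibB-fib j = refl

iotaBar-window : ∀ m {y} → 0 < y → y < F (2 + m) → iotaBar (F (3 + m) + y) ≡ F m + y
iotaBar-window m {y} 0<y y<F₂
  rewrite isFibB-between (4 + m) (m<m+n (F (3 + m)) 0<y) (+-monoʳ-< (F (3 + m)) y<F₂)
        | idx-between (3 + m) (m≤m+n (F (3 + m)) y) (+-monoʳ-< (F (3 + m)) y<F₂) = begin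
  F (3 + m) + y ∸ 2 * F (1 + m)           ≡⟨ cong (_∸ 2 * F (1 + m)) (regroup (F (1 + m)) (F m) y) ⟩
  F m + y + 2 * F (1 + m) ∸ 2 * F (1 + m) ≡⟨ m+n∸n≡m (F m + y) (2 * F (1 + m)) ⟩
  F m + y                                 ∎
  where
  open ≡-Reasoning
  regroup : ∀ a b y → a + b + a + y ≡ b + y + 2 * a
  regroup = solve-∀

iterate-suc : ∀ f k x → iterate f k (f x) ≡ iterate f (suc k) x
iterate-suc f zero    x = refl
iterate-suc f (suc k) x = cong f (iterate-suc f k x)

iterate-+ : ∀ f d k x → iterate f (d + k) x ≡ iterate f d (iterate f k x)
iterate-+ f zero    k x = refl
iterate-+ f (suc d) k x = cong f (iterate-+ f d k x)

iterate-fixed : ∀ {f y} → f y ≡ y → ∀ k → iterate f k y ≡ y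
iterate-fixed fy≡y zero        = refl
iterate-fixed {f} fy≡y (suc k) = trans (cong f (iterate-fixed fy≡y k)) fy≡y

iterate-≤ : ∀ {f} → (∀ x → f x ≤ x) → ∀ k x → iterate f k x ≤ x
iterate-≤ f-≤ zero    x = ≤-refl
iterate-≤ f-≤ (suc k) x = ≤-trans (f-≤ _) (iterate-≤ f-≤ k x)

iterate-reaches-fixed-point : ∀ {f} → (∀ x → f x ≤ x) → ∀ x → ∃ λ K → f (iterate f K x) ≡ iterate f K x
iterate-reaches-fixed-point {f} f-≤ = <-rec _ reach
  where
  reach : ∀ x → (∀ {x'} → x' < x → ∃ λ K → f (iterate f K x') ≡ iterate f K x') →
          ∃ λ K → f (iterate f K x) ≡ iterate f K x
  reach x rec with f x ≟ x
  ... | yes fx≡x = 0 , fx≡x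
  ... | no  fx≢x with rec (≤∧≢⇒< (f-≤ x) fx≢x)
  ...   | K , fixed = suc K , subst (λ v → f v ≡ v) (iterate-suc f K x) fixed

iterate-stable : ∀ {f K x} → f (iterate f K x) ≡ iterate f K x → ∀ k → K ≤ k → iterate f k x ≡ iterate f K x
iterate-stable {f} {K} {x} fixed k K≤k = begin
  iterate f k x                         ≡⟨ cong (λ j → iterate f j x) (sym (m∸n+n≡m K≤k)) ⟩
  iterate f (k ∸ K + K) x               ≡⟨ iterate-+ f (k ∸ K) K x ⟩
  iterate f (k ∸ K) (iterate f K x)     ≡⟨ iterate-fixed fixed (k ∸ K) ⟩
  iterate f K x                         ∎
  where open ≡-Reasoning

abstract
  alpha : ℕ → ℕ
  alpha x = iterate iotaBar (proj₁ (iterate-reaches-fixed-point iotaBar-≤ x)) x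

  alpha-isAlphaBar : ∀ x → IsAlphaBar x (alpha x)
  alpha-isAlphaBar x with iterate-reaches-fixed-point iotaBar-≤ x
  ... | K , fixed = K , iterate-stable fixed

IsAlphaBar-unique : ∀ {x a b} → IsAlphaBar x a → IsAlphaBar x b → a ≡ b
IsAlphaBar-unique (K , lim-a) (K' , lim-b) = trans (sym (lim-a (K + K') (m≤m+n K K'))) (lim-b (K + K') (m≤n+m K' K))

alpha-≤ : ∀ x → alpha x ≤ x
alpha-≤ x with alpha-isAlphaBar x
... | K , lim = subst (_≤ x) (lim K ≤-refl) (iterate-≤ iotaBar-≤ K x)

alpha-iotaBar : ∀ x → alpha (iotaBar x) ≡ alpha x
alpha-iotaBar x with alpha-isAlphaBar x
... | K , lim = IsAlphaBar-unique (alpha-isAlphaBar (iotaBar x))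
                  (K , λ k K≤k → trans (iterate-suc iotaBar k x) (lim (suc k) (m≤n⇒m≤1+n K≤k)))

alpha-fixed : ∀ {x} → iotaBar x ≡ x → alpha x ≡ x
alpha-fixed ιx≡x = IsAlphaBar-unique (alpha-isAlphaBar _) (0 , λ k _ → iterate-fixed ιx≡x k)

alpha-F : ∀ i → alpha (F i) ≡ F i
alpha-F i = alpha-fixed (iotaBar-fib (suc i))

alpha-window : ∀ m {y} → 0 < y → y < F (2 + m) → alpha (F (3 + m) + y) ≡ alpha (F m + y)
alpha-window m 0<y y<F₂ = trans (sym (alpha-iotaBar _)) (cong alpha (iotaBar-window m 0<y y<F₂))

alpha-F₊₁+F₋₁ : ∀ m → alpha (F (3 + m) + F (1 + m)) ≡ F (2 + m)
alpha-F₊₁+F₋₁ m = begin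
  alpha (F (3 + m) + F (1 + m)) ≡⟨ alpha-window m (F-pos (1 + m)) (F₊₁<F₊₂ m) ⟩
  alpha (F m + F (1 + m))       ≡⟨ cong alpha (+-comm (F m) (F (1 + m))) ⟩
  alpha (F (2 + m))             ≡⟨ alpha-F (2 + m) ⟩
  F (2 + m)                     ∎
  where open ≡-Reasoning

alpha-F₊₂+F₋₂ : ∀ m → alpha (F (4 + m) + F m) ≡ F (2 + m)
alpha-F₊₂+F₋₂ m = trans (alpha-window (1 + m) (F-pos m) (<-≤-trans (F<F₊₂ m) (F-mono (n≤1+n (2 + m))))) (alpha-F (2 + m))

-- Gaps and consecutive elements of a set of naturals

Gap : (ℕ → Set) → ℕ → ℕ → Set
Gap P x z = ∀ w → x < w → w < z → ¬ P w

Consecutive : (ℕ → Set) → ℕ → ℕ → Set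
Consecutive P x z = x < z × P x × P z × Gap P x z

module _ {P : ℕ → Set} where

  Gap-suc : ∀ {x} → Gap P x (suc x)
  Gap-suc w x<w w<1+x = ⊥-elim (<⇒≱ x<w (≤-pred w<1+x))

  Gap-⊆ : ∀ {lo hi lo' hi'} → lo ≤ lo' → hi' ≤ hi → Gap P lo hi → Gap P lo' hi'
  Gap-⊆ lo≤lo' hi'≤hi gap w lo'<w w<hi' = gap w (≤-<-trans lo≤lo' lo'<w) (<-≤-trans w<hi' hi'≤hi)

  Gap-weaken : ∀ {R : ℕ → Set} {x z} → (∀ {w} → R w → P w) → Gap P x z → Gap R x z
  Gap-weaken R⊆P gap w x<w w<z = gap w x<w w<z ∘ R⊆P

  Gap-next : ∀ {x z w} → Gap P x z → x < w → P w → z ≤ w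
  Gap-next gap x<w Pw = ≮⇒≥ λ w<z → gap _ x<w w<z Pw

  Gap-cons : ∀ {x z} → ¬ P (suc x) → Gap P (suc x) z → Gap P x z
  Gap-cons ¬P gap w x<w w<z with m≤n⇒m<n∨m≡n x<w
  ... | inj₁ 1+x<w = gap w 1+x<w w<z
  ... | inj₂ refl  = ¬P

  Gap-snoc : ∀ {x z} → Gap P x z → ¬ P z → Gap P x (suc z)
  Gap-snoc gap ¬P w x<w w<1+z with m≤n⇒m<n∨m≡n (≤-pred w<1+z)
  ... | inj₁ w<z  = gap w x<w w<z
  ... | inj₂ refl = ¬P

  Gap-join : ∀ {x u z} → Gap P x (suc u) → Gap P u z → Gap P x z
  Gap-join {u = u} gap₁ gap₂ w x<w w<z with w ≤? u
  ... | yes w≤u = gap₁ w x<w (s≤s w≤u)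
  ... | no  w≰u = gap₂ w (≰⇒> w≰u) w<z

  Gap-between-gaps : ∀ {x y z w} → Gap P x y → Gap P y z → x < w → w < z → P w → w ≡ y
  Gap-between-gaps {y = y} {w = w} gap₁ gap₂ x<w w<z Pw with <-cmp w y
  ... | tri< w<y _ _ = ⊥-elim (gap₁ w x<w w<y Pw)
  ... | tri≈ _ w≡y _ = w≡y
  ... | tri> _ _ y<w = ⊥-elim (gap₂ w y<w w<z Pw)

  Gap⇒closed₂ : ∀ {x z} → Gap P x z → ∀ w → x ≤ w → w ≤ z → P w → w ≡ x ⊎ w ≡ z
  Gap⇒closed₂ gap w x≤w w≤z Pw with m≤n⇒m<n∨m≡n x≤w | m≤n⇒m<n∨m≡n w≤z
  ... | inj₂ refl | _         = inj₁ refl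
  ... | inj₁ _    | inj₂ refl = inj₂ refl
  ... | inj₁ x<w  | inj₁ w<z  = ⊥-elim (gap w x<w w<z Pw)

  closed₂⇒Gap : ∀ {x z} → (∀ w → x ≤ w → w ≤ z → P w → w ≡ x ⊎ w ≡ z) → Gap P x z
  closed₂⇒Gap closed w x<w w<z Pw with closed w (<⇒≤ x<w) (<⇒≤ w<z) Pw
  ... | inj₁ refl = <-irrefl refl x<w
  ... | inj₂ refl = <-irrefl refl w<z

  Gaps⇒closed₃ : ∀ {x y z} → Gap P x y → Gap P y z → ∀ w → x ≤ w → w ≤ z → P w → w ≡ x ⊎ w ≡ y ⊎ w ≡ z
  Gaps⇒closed₃ gap₁ gap₂ w x≤w w≤z Pw with m≤n⇒m<n∨m≡n x≤w | m≤n⇒m<n∨m≡n w≤z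
  ... | inj₂ refl | _         = inj₁ refl
  ... | inj₁ _    | inj₂ refl = inj₂ (inj₂ refl)
  ... | inj₁ x<w  | inj₁ w<z  = inj₂ (inj₁ (Gap-between-gaps gap₁ gap₂ x<w w<z Pw))

  closed₃⇒Gaps : ∀ {x y z} → x < y → y < z → (∀ w → x ≤ w → w ≤ z → P w → w ≡ x ⊎ w ≡ y ⊎ w ≡ z) →
                 Gap P x y × Gap P y z
  closed₃⇒Gaps {x} {y} {z} x<y y<z closed = below-y , above-y
    where
    below-y : Gap P x y
    below-y w x<w w<y Pw with closed w (<⇒≤ x<w) (<⇒≤ (<-trans w<y y<z)) Pw
    ... | inj₁ refl        = <-irrefl refl x<w
    ... | inj₂ (inj₁ refl) = <-irrefl refl w<y
    ... | inj₂ (inj₂ refl) = <-asym w<y y<z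
    above-y : Gap P y z
    above-y w y<w w<z Pw with closed w (<⇒≤ (<-trans x<y y<w)) (<⇒≤ w<z) Pw
    ... | inj₁ refl        = <-asym x<y y<w
    ... | inj₂ (inj₁ refl) = <-irrefl refl y<w
    ... | inj₂ (inj₂ refl) = <-irrefl refl w<z

  Gap-shift : ∀ c c' {lo hi} → (∀ {y} → lo < y → y < hi → P (c' + y) → P (c + y)) →
              Gap P (c + lo) (c + hi) → Gap P (c' + lo) (c' + hi)
  Gap-shift c c' {lo} {hi} back gap w c'+lo<w w<c'+hi Pw with above-base c' c'+lo<w
  ... | y , refl , lo<y = gap (c + y) (+-monoʳ-< c lo<y) (+-monoʳ-< c y<hi) (back lo<y y<hi Pw)
    where
    y<hi : y < hi
    y<hi = +-cancelˡ-< c' y hi w<c'+hi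

module _ {P : ℕ → Set} (P? : Decidable P) where

  last-≤ : ∀ {lo} u → P lo → lo ≤ u → ∃ λ x → x ≤ u × P x × Gap P x (suc u)
  last-≤ zero    Plo z≤n = 0 , z≤n , Plo , Gap-suc
  last-≤ (suc u) Plo lo≤1+u with P? (suc u) | m≤n⇒m<n∨m≡n lo≤1+u
  ... | yes P1+u | _         = suc u , ≤-refl , P1+u , Gap-suc
  ... | no ¬P1+u | inj₂ refl = ⊥-elim (¬P1+u Plo)
  ... | no ¬P1+u | inj₁ lo<1+u with last-≤ u Plo (≤-pred lo<1+u)
  ...   | x , x≤u , Px , gap = x , m≤n⇒m≤1+n x≤u , Px , Gap-snoc gap ¬P1+u

  first-> : ∀ d u → P (suc (d + u)) → ∃ λ z → u < z × P z × Gap P u z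
  first-> zero    u P1+u = suc u , ≤-refl , P1+u , Gap-suc
  first-> (suc d) u Pd with P? (suc u)
  ... | yes P1+u = suc u , ≤-refl , P1+u , Gap-suc
  ... | no ¬P1+u with first-> d (suc u) (subst (P ∘ suc) (sym (+-suc d u)) Pd)
  ...   | z , 1+u<z , Pz , gap = z , <-trans (n<1+n u) 1+u<z , Pz , Gap-cons ¬P1+u gap

  enclosing : ∀ {lo u hi} → P lo → lo ≤ u → u < hi → P hi → ∃₂ λ x z → x ≤ u × u < z × Consecutive P x z
  enclosing {u = u} {hi} Plo lo≤u u<hi Phi
    with last-≤ u Plo lo≤u | first-> (hi ∸ suc u) u (subst P (sym (trans (sym (+-suc _ u)) (m∸n+n≡m u<hi))) Phi)
  ... | x , x≤u , Px , gap₁ | z , u<z , Pz , gap₂ = x , z , x≤u , u<z , (≤-<-trans x≤u u<z , Px , Pz , Gap-join gap₁ gap₂)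

-- The sets V̄_j

-- Membership in V̄_j, as a record so that j and w are inferable from V j w.
record V (j w : ℕ) : Set where
  constructor mkV
  field F≤alpha : F j ≤ alpha w

open V

V? : ∀ j → Decidable (V j)
V? j w = map′ mkV F≤alpha (F j ≤? alpha w)

VBar⇒V : ∀ {j w} → VBar j w → V j w
VBar⇒V {j} {w} (_ , lim , Fj≤a) = mkV (subst (F j ≤_) (IsAlphaBar-unique lim (alpha-isAlphaBar w)) Fj≤a)

V⇒VBar : ∀ {j w} → V j w → VBar j w
V⇒VBar {w = w} (mkV Fj≤α) = alpha w , alpha-isAlphaBar w , Fj≤α

V-≤ : ∀ {j w} → V j w → F j ≤ w
V-≤ {w = w} (mkV Fj≤α) = ≤-trans Fj≤α (alpha-≤ w)

V-antimono : ∀ {i j w} → i ≤ j → V j w → V i w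
V-antimono i≤j (mkV Fj≤α) = mkV (≤-trans (F-mono i≤j) Fj≤α)

V-cong : ∀ {j u w} → alpha u ≡ alpha w → V j u → V j w
V-cong {j} αu≡αw (mkV Fj≤α) = mkV (subst (F j ≤_) αu≡αw Fj≤α)

V-alpha≡F : ∀ {i j w} → alpha w ≡ F i → j ≤ i → V j w
V-alpha≡F {j = j} αw≡Fi j≤i = mkV (subst (F j ≤_) (sym αw≡Fi) (F-mono j≤i))

V-F : ∀ {i j} → j ≤ i → V j (F i)
V-F {i} = V-alpha≡F (alpha-F i)

¬V-alpha≡F : ∀ {i j w} → alpha w ≡ F i → F i < F j → ¬ V j w
¬V-alpha≡F {j = j} αw≡Fi Fi<Fj (mkV Fj≤α) = <⇒≱ Fi<Fj (subst (F j ≤_) αw≡Fi Fj≤α)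


Gap-below : ∀ {j x z} → z ≤ F j → Gap (V j) x z
Gap-below z≤Fj w _ w<z Vw = <⇒≱ (<-≤-trans w<z z≤Fj) (V-≤ Vw)

Gap-window : ∀ j m lo hi → hi ≤ F (2 + m) → Gap (V j) (F m + lo) (F m + hi) → Gap (V j) (F (3 + m) + lo) (F (3 + m) + hi)
Gap-window j m lo hi hi≤F₂ = Gap-shift (F m) (F (3 + m))
  λ lo<y y<hi → V-cong (alpha-window m (≤-<-trans z≤n lo<y) (<-≤-trans y<hi hi≤F₂))

Gap-window⁻ : ∀ j m lo hi → hi ≤ F (2 + m) → Gap (V j) (F (3 + m) + lo) (F (3 + m) + hi) → Gap (V j) (F m + lo) (F m + hi)
Gap-window⁻ j m lo hi hi≤F₂ = Gap-shift (F (3 + m)) (F m)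
  λ lo<y y<hi → V-cong (sym (alpha-window m (≤-<-trans z≤n lo<y) (<-≤-trans y<hi hi≤F₂)))

Gap-F : ∀ j → Gap (V j) (F j) (F (suc j))
Gap-F 0 w 1<w w<1 _ = <-asym 1<w w<1
Gap-F 1 w 1<w w<2 _ = <⇒≱ 1<w (≤-pred w<2)
Gap-F 2 w 2<w w<3 _ = <⇒≱ 2<w (≤-pred w<3)
Gap-F (suc (suc (suc m))) =
  Gap-⊆ (≤-reflexive (+-identityʳ _)) ≤-refl (Gap-window (3 + m) m 0 (F (2 + m)) ≤-refl (Gap-below Fm+F₂≤F₃))
  where
  Fm+F₂≤F₃ : F m + F (2 + m) ≤ F (3 + m)
  Fm+F₂≤F₃ = ≤-trans (≤-reflexive (+-comm (F m) (F (2 + m)))) (+-monoʳ-≤ (F (2 + m)) (F-mono (n≤1+n m)))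

V-F+F₊₂ : ∀ {j} m → j ≤ m → V j (F m + F (2 + m))
V-F+F₊₂ zero    j≤0   = V-F {3} (≤-trans j≤0 z≤n)
V-F+F₊₂ (suc m) j≤1+m = V-alpha≡F (trans (cong alpha (+-comm (F (suc m)) (F (3 + m)))) (alpha-F₊₁+F₋₁ m)) (m≤n⇒m≤1+n j≤1+m)

V-window⁻ : ∀ {j} m {y} → j ≤ m → y ≤ F (2 + m) → V j (F (3 + m) + y) → V j (F m + y)
V-window⁻ {j} m {zero}  j≤m _    _   = subst (V j) (sym (+-identityʳ (F m))) (V-F j≤m)
V-window⁻ {j} m {suc y} j≤m y≤F₂ V₃ with m≤n⇒m<n∨m≡n y≤F₂
... | inj₁ y<F₂ = V-cong (alpha-window m (s≤s z≤n) y<F₂) V₃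
... | inj₂ y≡F₂ = subst (λ v → V j (F m + v)) (sym y≡F₂) (V-F+F₊₂ m j≤m)

-- Consecutive elements of V̄_{ℓ+1}, for ℓ = 2 + n

module Level (n : ℕ) where

  P Q : ℕ → Set
  P = V (2 + n)
  Q = V (3 + n)

  Q⇒P : ∀ {w} → Q w → P w
  Q⇒P = V-antimono (n≤1+n (2 + n))

  ShortGap LongGap GapShape : ℕ → ℕ → Set
  ShortGap x z = z ≡ x + F (1 + n) × Gap P x z
  LongGap  x z = z ≡ x + F (2 + n) × ∃ λ y → x < y × y < z × P y × ¬ Q y × Gap P x y × Gap P y z
  GapShape x z = ShortGap x z ⊎ LongGap x z

  long : ∀ {x y z} → z ≡ x + F (2 + n) → x < y → y < z → alpha y ≡ F (2 + n) →
         Gap P x y → Gap P y z → GapShape x z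
  long z≡x+F₂ x<y y<z αy≡F₂ gap₁ gap₂ =
    inj₂ (z≡x+F₂ , _ , x<y , y<z , V-alpha≡F {2 + n} αy≡F₂ ≤-refl , ¬V-alpha≡F {2 + n} αy≡F₂ (F₊₁<F₊₂ (1 + n)) , gap₁ , gap₂)

  GapShape-< : ∀ {x z} → GapShape x z → x < z
  GapShape-< (inj₁ (refl , _)) = m<m+n _ (F-pos (1 + n))
  GapShape-< (inj₂ (refl , _)) = m<m+n _ (F-pos (2 + n))

  GapShape-skip : ∀ {x z w} → GapShape x z → x < w → Q w → z ≤ w
  GapShape-skip (inj₁ (_ , gap)) x<w Qw = Gap-next gap x<w (Q⇒P Qw)
  GapShape-skip {w = w} (inj₂ (_ , y , _ , _ , _ , ¬Qy , gap₁ , gap₂)) x<w Qw = Gap-next gap₂ y<w (Q⇒P Qw)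
    where
    y<w : y < w
    y<w = ≤∧≢⇒< (Gap-next gap₁ x<w (Q⇒P Qw)) λ { refl → ¬Qy Qw }

  GapShape-next : ∀ {x y z} → GapShape x y → Q y → Consecutive Q x z → z ≡ y
  GapShape-next shape Qy (x<z , _ , Qz , gap) = ≤-antisym (Gap-next gap (GapShape-< shape) Qy) (GapShape-skip shape x<z Qz)

  infixr 5 _∷_
  data Chain : ℕ → ℕ → Set where
    []  : ∀ {x} → Chain x x
    _∷_ : ∀ {x y z} → Q y × GapShape x y → Chain y z → Chain x z

  Chain-shape : ∀ {h e x z} → Chain h e → h ≤ x → x < e → Q x → Consecutive Q x z → GapShape x z
  Chain-shape [] h≤x x<h _ _ = ⊥-elim (<⇒≱ x<h h≤x)
  Chain-shape {x = x} ((Qy , shape) ∷ chain) h≤x x<e Qx cons with m≤n⇒m<n∨m≡n h≤x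
  ... | inj₂ refl = subst (GapShape x) (sym (GapShape-next shape Qy cons)) shape
  ... | inj₁ h<x  = Chain-shape chain (GapShape-skip shape h<x Qx) x<e Qx cons

  -- The elements of V̄_{ℓ+1} in [F (3 + n), F (6 + n)] are h₀ = F (3 + n), h₁ = F (4 + n),
  -- h₂ = h₁ + F (2 + n), h₃ = F (5 + n), h₄ = h₃ + F (1 + n), h₅ = h₃ + F (3 + n), h₆ = F (6 + n);
  -- the other elements of V̄_ℓ there are m₁ = h₀ + F (1 + n), m₂ = h₁ + F n, m₅ = h₄ + F (1 + n)
  -- and m₆ = h₃ + 2 F (2 + n). Each gap is the translate (Gap-window) of a gap below F ℓ, of
  -- (F ℓ, F (ℓ + 1)), or of a gap already found.
  base-chain : Chain (F (3 + n)) (F (6 + n))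
  base-chain =
      (V-F (n≤1+n _) , long refl (m<m+n _ a>0) (+-monoʳ-< (F (3 + n)) a<F₂) (alpha-F₊₁+F₋₁ n) gap-h₀-m₁ gap-m₁-h₁)
    ∷ (V-alpha≡F (alpha-F₊₁+F₋₁ (1 + n)) ≤-refl ,
       long refl (m<m+n _ (F-pos n)) (+-monoʳ-< (F (4 + n)) b<F₂) (alpha-F₊₂+F₋₂ n) gap-h₁-m₂ gap-m₂-h₂)
    ∷ (V-F (m≤n+m _ 2) , inj₁ (sym (+-assoc (F (4 + n)) (F (2 + n)) a) , gap-h₂-h₃))
    ∷ (V-alpha≡F (alpha-F₊₂+F₋₂ (1 + n)) ≤-refl , inj₁ (refl , gap-h₃-h₄))
    ∷ (V-alpha≡F (alpha-F₊₁+F₋₁ (2 + n)) (n≤1+n _) ,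
       long h₅≡h₄+F₂ (+-monoʳ-< (F (5 + n)) (m<m+n a a>0)) (+-monoʳ-< (F (5 + n)) a+a<F₃) α-m₅ gap-h₄-m₅ gap-m₅-h₅)
    ∷ (V-F (m≤n+m _ 3) ,
       long (sym (+-assoc (F (5 + n)) (F (3 + n)) (F (2 + n))))
            (+-monoʳ-< (F (5 + n)) (+-monoʳ-< (F (2 + n)) a<F₂)) (+-monoʳ-< (F (5 + n)) 2F₂<F₄) α-m₆ gap-h₅-m₆ gap-m₆-h₆)
    ∷ []
    where
    a b : ℕ
    a = F (1 + n)
    b = F n

    a>0 : 0 < a
    a>0 = F-pos (1 + n)

    a<F₂ : a < F (2 + n)
    a<F₂ = F₊₁<F₊₂ n

    b<F₂ : b < F (2 + n)
    b<F₂ = m<n+m b a>0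

    a+a<F₃ : a + a < F (3 + n)
    a+a<F₃ = +-monoˡ-< a a<F₂

    2F₂<F₄ : F (2 + n) + F (2 + n) < F (4 + n)
    2F₂<F₄ = +-monoˡ-< (F (2 + n)) (F₊₁<F₊₂ (1 + n))

    3F₂≡F₄+b : F (2 + n) + (F (2 + n) + F (2 + n)) ≡ F (4 + n) + b
    3F₂≡F₄+b = lemma a b
      where
      lemma : ∀ a b → (a + b) + ((a + b) + (a + b)) ≡ (((a + b) + a) + (a + b)) + b
      lemma = solve-∀

    h₅≡h₄+F₂ : F (5 + n) + F (3 + n) ≡ F (5 + n) + a + F (2 + n)
    h₅≡h₄+F₂ = trans (cong (F (5 + n) +_) (+-comm (F (2 + n)) a)) (sym (+-assoc (F (5 + n)) a (F (2 + n))))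

    α-m₅ : alpha (F (5 + n) + (a + a)) ≡ F (2 + n)
    α-m₅ = begin
      alpha (F (5 + n) + (a + a)) ≡⟨ alpha-window (2 + n) (<-≤-trans a>0 (m≤m+n a a)) (<-trans a+a<F₃ (F₊₁<F₊₂ (2 + n))) ⟩
      alpha (F (2 + n) + (a + a)) ≡⟨ cong alpha (sym (+-assoc (F (2 + n)) a a)) ⟩
      alpha (F (3 + n) + a)       ≡⟨ alpha-F₊₁+F₋₁ n ⟩
      F (2 + n)                   ∎
      where open ≡-Reasoning

    α-m₆ : alpha (F (5 + n) + (F (2 + n) + F (2 + n))) ≡ F (2 + n)
    α-m₆ = begin
      alpha (F (5 + n) + (F (2 + n) + F (2 + n))) ≡⟨ alpha-window (2 + n) (<-≤-trans (F-pos (2 + n)) (m≤m+n _ _)) 2F₂<F₄ ⟩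
      alpha (F (2 + n) + (F (2 + n) + F (2 + n))) ≡⟨ cong alpha 3F₂≡F₄+b ⟩
      alpha (F (4 + n) + b)                       ≡⟨ alpha-F₊₂+F₋₂ n ⟩
      F (2 + n)                                   ∎
      where open ≡-Reasoning

    gap-h₀-m₁ : Gap P (F (3 + n)) (F (3 + n) + a)
    gap-h₀-m₁ = Gap-⊆ (≤-reflexive (+-identityʳ _)) ≤-refl
      (Gap-window (2 + n) n 0 a (<⇒≤ a<F₂) (Gap-below (≤-reflexive (+-comm b a))))

    gap-m₁-h₁ : Gap P (F (3 + n) + a) (F (4 + n))
    gap-m₁-h₁ = Gap-window (2 + n) n a (F (2 + n)) ≤-refl
      (Gap-⊆ (≤-reflexive (+-comm a b)) (≤-trans (≤-reflexive (+-comm b (F (2 + n)))) (+-monoʳ-≤ (F (2 + n)) (F-mono (n≤1+n n))))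
             (Gap-F (2 + n)))

    gap-h₁-m₂ : Gap P (F (4 + n)) (F (4 + n) + b)
    gap-h₁-m₂ = Gap-⊆ (≤-reflexive (+-identityʳ _)) ≤-refl
      (Gap-window (2 + n) (1 + n) 0 b (F-mono (m≤n+m n 3)) (Gap-below ≤-refl))

    gap-m₂-h₂ : Gap P (F (4 + n) + b) (F (4 + n) + F (2 + n))
    gap-m₂-h₂ = Gap-window (2 + n) (1 + n) b (F (2 + n)) (F-mono (n≤1+n (2 + n)))
      (Gap-⊆ ≤-refl (≤-reflexive (+-comm a (F (2 + n)))) (Gap-F (2 + n)))

    gap-h₂-h₃ : Gap P (F (4 + n) + F (2 + n)) (F (5 + n))
    gap-h₂-h₃ = Gap-window (2 + n) (1 + n) (F (2 + n)) (F (3 + n)) ≤-refl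
      (Gap-⊆ (≤-reflexive (+-comm (F (2 + n)) a)) (≤-reflexive (+-comm a (F (3 + n)))) gap-h₀-m₁)

    gap-h₃-h₄ : Gap P (F (5 + n)) (F (5 + n) + a)
    gap-h₃-h₄ = Gap-⊆ (≤-reflexive (+-identityʳ _)) ≤-refl
      (Gap-window (2 + n) (2 + n) 0 a (F-mono (m≤n+m (1 + n) 3)) (Gap-⊆ (m≤m+n _ 0) ≤-refl (Gap-F (2 + n))))

    gap-h₄-m₅ : Gap P (F (5 + n) + a) (F (5 + n) + (a + a))
    gap-h₄-m₅ = Gap-window (2 + n) (2 + n) a (a + a) (<⇒≤ (<-trans a+a<F₃ (F₊₁<F₊₂ (2 + n))))
      (Gap-⊆ ≤-refl (≤-reflexive (sym (+-assoc (F (2 + n)) a a))) gap-h₀-m₁)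

    gap-m₅-h₅ : Gap P (F (5 + n) + (a + a)) (F (5 + n) + F (3 + n))
    gap-m₅-h₅ = Gap-window (2 + n) (2 + n) (a + a) (F (3 + n)) (F-mono (n≤1+n (3 + n)))
      (Gap-⊆ (≤-reflexive (+-assoc (F (2 + n)) a a)) (≤-reflexive (+-comm (F (2 + n)) (F (3 + n)))) gap-m₁-h₁)

    gap-h₅-m₆ : Gap P (F (5 + n) + F (3 + n)) (F (5 + n) + (F (2 + n) + F (2 + n)))
    gap-h₅-m₆ = Gap-window (2 + n) (2 + n) (F (3 + n)) (F (2 + n) + F (2 + n)) (<⇒≤ 2F₂<F₄)
      (Gap-⊆ (≤-reflexive (+-comm (F (3 + n)) (F (2 + n)))) (≤-reflexive 3F₂≡F₄+b) gap-h₁-m₂)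

    gap-m₆-h₆ : Gap P (F (5 + n) + (F (2 + n) + F (2 + n))) (F (6 + n))
    gap-m₆-h₆ = Gap-window (2 + n) (2 + n) (F (2 + n) + F (2 + n)) (F (4 + n)) ≤-refl
      (Gap-⊆ (≤-reflexive (sym 3F₂≡F₄+b)) (≤-reflexive (+-comm (F (2 + n)) (F (4 + n)))) gap-m₂-h₂)

  base-shape : ∀ {x z} → x < F (6 + n) → Consecutive Q x z → GapShape x z
  base-shape x<F₆ cons@(_ , Qx , _) = Chain-shape base-chain (V-≤ Qx) x<F₆ Qx cons

  -- F m + y ↦ F (3 + m) + y preserves ᾱ for 0 < y < F (2 + m), and the ends y = 0 and
  -- y = F (2 + m) lie in V̄_{ℓ+1} on both sides once m ≥ ℓ + 1.
  window-shape : ∀ m {yx yz} → 3 + n ≤ m → yx < F (2 + m) →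
    (Consecutive Q (F m + yx) (F m + yz) → GapShape (F m + yx) (F m + yz)) →
    Consecutive Q (F (3 + m) + yx) (F (3 + m) + yz) → GapShape (F (3 + m) + yx) (F (3 + m) + yz)
  window-shape m {yx} {yz} 3+n≤m yx<F₂ shape-below (x<z , Qx , Qz , gap) =
    lift (shape-below (+-monoʳ-< (F m) yx<yz , V-window⁻ m 3+n≤m (<⇒≤ yx<F₂) Qx , V-window⁻ m 3+n≤m yz≤F₂ Qz ,
                       Gap-window⁻ (3 + n) m yx yz yz≤F₂ gap))
    where
    yx<yz : yx < yz
    yx<yz = +-cancelˡ-< (F (3 + m)) yx yz x<z

    yz≤F₂ : yz ≤ F (2 + m)
    yz≤F₂ = +-cancelˡ-≤ (F (3 + m)) yz (F (2 + m))
      (Gap-next gap (+-monoʳ-< (F (3 + m)) yx<F₂) (V-F (≤-trans 3+n≤m (m≤n+m m 4))))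

    lift : GapShape (F m + yx) (F m + yz) → GapShape (F (3 + m) + yx) (F (3 + m) + yz)
    lift (inj₁ (e , gap₀)) = inj₁ (+-rebase (F m) (F (3 + m)) e , Gap-window (2 + n) m yx yz yz≤F₂ gap₀)
    lift (inj₂ (e , y , x<y , y<z , Py , ¬Qy , gap₁ , gap₂)) with above-base (F m) x<y
    ... | yy , refl , yx<yy =
      inj₂ (+-rebase (F m) (F (3 + m)) e , F (3 + m) + yy , +-monoʳ-< (F (3 + m)) yx<yy , +-monoʳ-< (F (3 + m)) yy<yz ,
            V-cong (sym α≡) Py , ¬Qy ∘ V-cong α≡ ,
            Gap-window (2 + n) m yx yy (<⇒≤ (<-≤-trans yy<yz yz≤F₂)) gap₁ , Gap-window (2 + n) m yy yz yz≤F₂ gap₂)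
      where
      yy<yz : yy < yz
      yy<yz = +-cancelˡ-< (F m) yy yz y<z
      α≡ : alpha (F (3 + m) + yy) ≡ alpha (F m + yy)
      α≡ = alpha-window m (≤-<-trans z≤n yx<yy) (<-≤-trans yy<yz yz≤F₂)

  consecutive-shape : ∀ {x z} → Consecutive Q x z → GapShape x z
  consecutive-shape {x} = <-rec (λ x → ∀ {z} → Consecutive Q x z → GapShape x z) shape-at x
    where
    shape-at : ∀ x → (∀ {x'} → x' < x → ∀ {z} → Consecutive Q x' z → GapShape x' z) →
               ∀ {z} → Consecutive Q x z → GapShape x z
    shape-at x rec {z} cons with x <? F (6 + n)
    ... | yes x<F₆ = base-shape x<F₆ cons
    ... | no  x≮F₆ with F-interval {6 + n} (≮⇒≥ x≮F₆)
    ...   | suc (suc (suc m)) , s≤s (s≤s (s≤s 3+n≤m)) , F₃≤x , x<F₄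
          with offset F₃≤x | offset (≤-trans F₃≤x (<⇒≤ (proj₁ cons)))
    ...     | yx , refl | yz , refl =
      window-shape m 3+n≤m (+-cancelˡ-< (F (3 + m)) yx (F (2 + m)) x<F₄)
                   (rec (+-monoˡ-< yx (<-≤-trans (F<F₊₂ m) (F-mono (n≤1+n (2 + m)))))) cons

  -- u and v are enclosed by consecutive elements of V̄_{ℓ+1}, between which V̄_ℓ has at most one element.
  no-consecutive-middles : ∀ {u v} → Consecutive P u v → ¬ Q u → ¬ Q v → ⊥
  no-consecutive-middles {u} {v} (u<v , Pu , Pv , gap) ¬Qu ¬Qv with v ≤? F (3 + n)
  ... | yes v≤F₃ = ¬Qv (subst Q (≤-antisym F₃≤v v≤F₃) (V-F ≤-refl))
    where
    F₃≤v : F (3 + n) ≤ v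
    F₃≤v = Gap-next (Gap-F (2 + n)) (≤-<-trans (V-≤ Pu) u<v) Pv
  ... | no  v≰F₃ = enclosed (enclosing (V? (3 + n)) (V-F ≤-refl) F₃≤u u<hi (V-F (m≤m+n (3 + n) v)))
    where
    F₃≤u : F (3 + n) ≤ u
    F₃≤u = ≮⇒≥ λ u<F₃ → gap (F (3 + n)) u<F₃ (≰⇒> v≰F₃) (Q⇒P (V-F ≤-refl))

    u<hi : u < F (3 + n + v)
    u<hi = <-trans u<v (<-≤-trans (n<F-suc v) (F-mono (s≤s (m≤n+m v (2 + n)))))

    enclosed : (∃₂ λ x z → x ≤ u × u < z × Consecutive Q x z) → ⊥
    enclosed (x , z , x≤u , u<z , cons@(_ , Qx , Qz , _)) = two-middles (consecutive-shape cons)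
      where
      x<u : x < u
      x<u = ≤∧≢⇒< x≤u λ { refl → ¬Qu Qx }

      v<z : v < z
      v<z = ≤∧≢⇒< (Gap-next gap u<z (Q⇒P Qz)) λ { refl → ¬Qv Qz }

      two-middles : GapShape x z → ⊥
      two-middles (inj₁ (_ , gapP)) = gapP u x<u u<z Pu
      two-middles (inj₂ (_ , y , _ , _ , _ , _ , gap₁ , gap₂)) = <-irrefl u≡v u<v
        where
        u≡v : u ≡ v
        u≡v = trans (Gap-between-gaps gap₁ gap₂ x<u u<z Pu) (sym (Gap-between-gaps gap₁ gap₂ (<-trans x<u u<v) v<z Pv))

  Split : ℕ → ℕ → Set
  Split x z = ∃ λ y → ¬ Q y × Consecutive P x y × Consecutive P y z

  LongGap⇒Split : ∀ {x z} → Q x → Q z → LongGap x z → Split x z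
  LongGap⇒Split Qx Qz (_ , y , x<y , y<z , Py , ¬Qy , gap₁ , gap₂) =
    y , ¬Qy , (x<y , Q⇒P Qx , Py , gap₁) , (y<z , Py , Q⇒P Qz , gap₂)

  Split⇒Consecutive : ∀ {x z} → Split x z → Consecutive Q x z
  Split⇒Consecutive {x} {z} (y , ¬Qy , xy@(x<y , _ , _ , gap₁) , yz@(y<z , _ , _ , gap₂)) =
    <-trans x<y y<z ,
    decidable-stable (V? (3 + n) x) (λ ¬Qx → no-consecutive-middles xy ¬Qx ¬Qy) ,
    decidable-stable (V? (3 + n) z) (λ ¬Qz → no-consecutive-middles yz ¬Qy ¬Qz) ,
    λ w x<w w<z Qw → ¬Qy (subst Q (Gap-between-gaps gap₁ gap₂ x<w w<z (Q⇒P Qw)) Qw)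

  i⇔ii : ∀ {x z} → (Consecutive Q x z × ¬ Consecutive P x z) ⇔ Split x z
  i⇔ii = mk⇔ i⇒ii ii⇒i
    where
    i⇒ii : ∀ {x z} → Consecutive Q x z × ¬ Consecutive P x z → Split x z
    i⇒ii (cons@(x<z , Qx , Qz , _) , ¬consP) with consecutive-shape cons
    ... | inj₁ (_ , gap) = ⊥-elim (¬consP (x<z , Q⇒P Qx , Q⇒P Qz , gap))
    ... | inj₂ long-gap = LongGap⇒Split Qx Qz long-gap
    ii⇒i : ∀ {x z} → Split x z → Consecutive Q x z × ¬ Consecutive P x z
    ii⇒i r@(y , _ , (x<y , _ , Py , _) , (y<z , _)) =
      Split⇒Consecutive r , λ (_ , _ , _ , gap) → gap y x<y y<z Py

  ii⇔iii : ∀ {x z} → Split x z ⇔ (Consecutive Q x z × z ∸ x ≡ F (2 + n))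
  ii⇔iii = mk⇔ ii⇒iii iii⇒ii
    where
    difference : ∀ x {z d} → z ≡ x + d → z ∸ x ≡ d
    difference x {d = d} refl = m+n∸m≡n x d
    ii⇒iii : ∀ {x z} → Split x z → Consecutive Q x z × z ∸ x ≡ F (2 + n)
    ii⇒iii {x} r@(y , _ , (x<y , _ , Py , _) , (y<z , _)) with consecutive-shape (Split⇒Consecutive r)
    ... | inj₁ (_ , gap) = ⊥-elim (gap y x<y y<z Py)
    ... | inj₂ (z≡x+F₂ , _) = Split⇒Consecutive r , difference x z≡x+F₂
    iii⇒ii : ∀ {x z} → Consecutive Q x z × z ∸ x ≡ F (2 + n) → Split x z
    iii⇒ii {x} (cons@(_ , Qx , Qz , _) , z∸x≡F₂) with consecutive-shape cons
    ... | inj₁ (z≡x+F₁ , _) = ⊥-elim (<-irrefl (trans (sym (difference x z≡x+F₁)) z∸x≡F₂) (F₊₁<F₊₂ n))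
    ... | inj₂ long-gap = LongGap⇒Split Qx Qz long-gap

  Consec3⇔Split : ∀ {x z} → (∃ λ y → VBar (2 + n) y × ¬ VBar (3 + n) y × Consec3 (2 + n) x y z) ⇔ Split x z
  Consec3⇔Split = mk⇔
    (λ (y , vy , ¬vy , x<y , y<z , vx , _ , vz , closed) →
       let gap₁ , gap₂ = closed₃⇒Gaps x<y y<z closed in
       y , ¬vy ∘ V⇒VBar , (x<y , VBar⇒V vx , VBar⇒V vy , Gap-weaken V⇒VBar gap₁) ,
                          (y<z , VBar⇒V vy , VBar⇒V vz , Gap-weaken V⇒VBar gap₂))
    (λ (y , ¬Qy , (x<y , Px , Py , gap₁) , (y<z , _ , Pz , gap₂)) →
       y , V⇒VBar Py , ¬Qy ∘ VBar⇒V , x<y , y<z , V⇒VBar Px , V⇒VBar Py , V⇒VBar Pz ,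
       Gaps⇒closed₃ (Gap-weaken VBar⇒V gap₁) (Gap-weaken VBar⇒V gap₂))

Consec2⇔Consecutive : ∀ {j x z} → Consec2 j x z ⇔ Consecutive (V j) x z
Consec2⇔Consecutive = mk⇔
  (λ (x<z , vx , vz , closed) → x<z , VBar⇒V vx , VBar⇒V vz , Gap-weaken V⇒VBar (closed₂⇒Gap closed))
  (λ (x<z , Vx , Vz , gap) → x<z , V⇒VBar Vx , V⇒VBar Vz , Gap⇒closed₂ (Gap-weaken VBar⇒V gap))

proposition4p11 : (ℓ x z : ℕ) → 2 ≤ ℓ → 0 < x → 0 < z → x < z →
    ((Consec2 (suc ℓ) x z × ¬ Consec2 ℓ x z)
      ⇔ (∃ λ y → VBar ℓ y × ¬ VBar (suc ℓ) y × Consec3 ℓ x y z))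
    × ((∃ λ y → VBar ℓ y × ¬ VBar (suc ℓ) y × Consec3 ℓ x y z)
      ⇔ (Consec2 (suc ℓ) x z × z ∸ x ≡ F ℓ))
proposition4p11 (suc (suc n)) x z _ _ _ _ =
  ⇔-trans (Consec2⇔Consecutive ×-⇔ →-cong-⇔ Consec2⇔Consecutive ⇔-refl) (⇔-trans i⇔ii (⇔-sym Consec3⇔Split)) ,
  ⇔-trans Consec3⇔Split (⇔-trans ii⇔iii (⇔-sym (Consec2⇔Consecutive ×-⇔ ⇔-refl)))
  where open Level n
proposition4p11 1 _ _ (s≤s ()) _ _ _
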